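{- Let $G$ be a graph with $n \ge 2$ vertices and minimum degree $\delta \ge 1$. Then $$\operatorname{avd}(G) \le \frac{2n(2^{\delta}-1) + n}{3(2^{\delta}-1) + 1},$$ and so $\operatorname{avd}(G) \le \frac{3n}{4}$.
   Context: Graphs are finite and simple. A set $S \subseteq V(G)$ is a dominating set of $G$ if every vertex of $G$ is in $S$ or adjacent to a vertex of $S$. Let $\mathcal{D}(G)$ be the collection of dominating sets of $G$. The average order of dominating sets is $\operatorname{avd}(G) = \frac{1}{|\mathcal{D}(G)|}\sum_{S \in \mathcal{D}(G)} |S|$. -}

module Defs where

open import Data.Bool using (Bool; true; false; _∧_; _∨_; if_then_else_)
open import Data.Nat using (ℕ; zero; suc; _+_; _*_; _∸_; _^_; _≤_)
open import Data.Fin using (Fin)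
open import Data.Fin.Subset using (Subset; ∣_∣; inside; outside)
open import Data.List using (List; []; _∷_; map; _++_; filter; length; foldr)
open import Data.Nat.ListAction using (sum)
open import Data.Vec using (Vec; []; _∷_; lookup; allFin; toList)
open import Data.Product using (Σ; ∃; _×_; _,_)
open import Relation.Binary.PropositionalEquality using (_≡_)
open import Relation.Nullary using (¬_)
open import Relation.Nullary.Decidable using (does)
open import Data.Bool using (_≟_)

record Graph (n : ℕ) : Set where
  field
    adj   : Fin n → Fin n → Bool
    sym   : ∀ u v → adj u v ≡ adj v u
    irref : ∀ v → adj v v ≡ false
open Graph public

degree : ∀ {n} → Graph n → Fin n → ℕ
degree {n} G v = length (filter (λ u → adj G v u ≟ true) (toList (allFin n)))

IsMinDegree : ∀ {n} → Graph n → ℕ → Set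
IsMinDegree {n} G δ = (∀ v → δ ≤ degree G v) × ∃ λ v → degree G v ≡ δ

dominatedBy : ∀ {n} → Graph n → Subset n → Fin n → Bool
dominatedBy {n} G S v =
  isIn (lookup S v) ∨ foldr _∨_ false (map (λ u → isIn (lookup S u) ∧ adj G v u) (toList (allFin n)))
  where
  isIn : Data.Fin.Subset.Side → Bool
  isIn inside = true
  isIn outside = false

isDominating : ∀ {n} → Graph n → Subset n → Bool
isDominating {n} G S = foldr _∧_ true (map (dominatedBy G S) (toList (allFin n)))

allSubsets : (n : ℕ) → List (Subset n)
allSubsets zero = [] ∷ []
allSubsets (suc n) = map (inside ∷_) (allSubsets n) ++ map (outside ∷_) (allSubsets n)

dominatingSets : ∀ {n} → Graph n → List (Subset n)
dominatingSets {n} G = filter (λ S → isDominating G S ≟ true) (allSubsets n)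

numDom : ∀ {n} → Graph n → ℕ
numDom G = length (dominatingSets G)

totalDomSize : ∀ {n} → Graph n → ℕ
totalDomSize G = sum (map ∣_∣ (dominatingSets G))

-- avd(G) ≤ p / q   (q > 0), stated by cross-multiplication:
-- totalDomSize / numDom ≤ p / q  ⇔  totalDomSize * q ≤ p * numDom
-- (numDom G > 0 always, since V(G) is dominating)
AvdLeq : ∀ {n} → Graph n → ℕ → ℕ → Set
AvdLeq G p q = totalDomSize G * q ≤ p * numDom G

-- Write D⁺(v) and D⁻(v) for the dominating sets containing, resp. avoiding, the vertex v.
-- Counting pairs (S, v) gives n |D| = Σᵥ |D⁺(v)| + Σᵥ |D⁻(v)| and Σ_{S ∈ D} |S| = Σᵥ |D⁺(v)|.
-- For v ∈ S ∈ D, either S − v is still dominating (at most |D⁻(v)| such S), or v has a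
-- private neighbour p ∉ S (each p ∉ S is private for at most one v, so these pairs number at
-- most Σᵥ |D⁻(v)|), or else v has no neighbour in S and S − v dominates every other vertex;
-- then the 2^deg(v) − 1 sets (S − v) ∪ X with ∅ ≠ X ⊆ N(v) are distinct dominating sets
-- avoiding v. With m = 2^δ − 1 this gives m Σᵥ |D⁺(v)| ≤ (2m + 1) Σᵥ |D⁻(v)|, which
-- rearranges to the bound; m ≥ 1 then gives 3n/4.

module Submission where

open import Data.Bool using (Bool; true; false; not; _∧_; _∨_)
open import Data.Bool.Properties using (T-≡; not-injective)
import Data.Bool as Bool
open import Data.Empty using (⊥; ⊥-elim)
open import Data.Fin using (Fin; zero; suc; _≟_)
open import Data.Fin.Properties using (suc-injective)
open import Data.Fin.Subset using (Subset; inside; outside; _─_; ∣_∣)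
open import Data.List using ([]; _∷_; _++_; map; filter; length; foldr)
open import Data.List.Membership.Propositional using (_∈_)
open import Data.List.Relation.Unary.Any using (here; there; satisfied)
open import Data.List.Relation.Unary.Any.Properties using (any⁻)
import Data.List.Relation.Unary.All as All
open import Data.List.Relation.Unary.All.Properties using (all⁺; all⁻)
open import Data.List.Properties using (map-++; map-∘)
open import Data.Nat using (ℕ; zero; suc; _+_; _*_; _∸_; _^_; _≤_; z≤n; _≡ᵇ_)
open import Data.Nat.Properties hiding (suc-injective) renaming (_≟_ to _≟ℕ_)
import Data.Nat.ListAction as L
open import Data.Nat.ListAction.Properties using (sum-++)
open import Data.Nat.Tactic.RingSolver using (solve-∀)
open import Data.Product using (∃; _×_; _,_; proj₂)
open import Data.Sum using (_⊎_; inj₁; inj₂)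
open import Data.Vec using ([]; _∷_; lookup; tabulate; allFin; toList; _[_]≔_)
open import Data.Vec.Properties using (lookup∘update′; []≔-idempotent; []≔-lookup; lookup∘tabulate)
open import Function using (id; _∘_; Equivalence)
open import Relation.Binary.PropositionalEquality
open import Relation.Nullary using (yes; no)

open import Algebra.Properties.Semiring.Sum +-*-semiring
  using (sum; sum-syntax; sum-cong-≗; sum-replicate-zero; ∑-distrib-+; ∑-comm; *-distribˡ-sum)
open import Algebra.Properties.CommutativeSemigroup +-commutativeSemigroup using (interchange)

open import Defs hiding (sym)

𝟙 : Bool → ℕ
𝟙 true  = 1
𝟙 false = 0

𝟙≤1 : ∀ b → 𝟙 b ≤ 1
𝟙≤1 true  = ≤-refl
𝟙≤1 false = z≤n

𝟙*≤ : ∀ b m → 𝟙 b * m ≤ m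
𝟙*≤ true  m = ≤-reflexive (+-identityʳ m)
𝟙*≤ false m = z≤n

𝟙*≢0 : ∀ b m → 𝟙 b * m ≢ 0 → b ≡ true × m ≢ 0
𝟙*≢0 true  m ≢0 = refl , λ m≡0 → ≢0 (trans (+-identityʳ m) m≡0)
𝟙*≢0 false m ≢0 = ⊥-elim (≢0 refl)

𝟙*-absorb : ∀ {b} m → (m ≢ 0 → b ≡ true) → m ≡ 𝟙 b * m
𝟙*-absorb {b} m m≢0⇒b with m ≟ℕ 0
... | yes refl = sym (*-zeroʳ (𝟙 b))
... | no  m≢0 rewrite m≢0⇒b m≢0 = sym (+-identityʳ m)

𝟙-split : ∀ d b → d ≡ d * 𝟙 b + d * 𝟙 (not b)
𝟙-split d true  = sym (trans (cong₂ _+_ (*-identityʳ d) (*-zeroʳ d)) (+-identityʳ d))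
𝟙-split d false = sym (trans (cong (_+ d * 1) (*-zeroʳ d)) (*-identityʳ d))

𝟙-leftover≢0 : ∀ d b d′ t → 𝟙 d * 𝟙 b ∸ 𝟙 b * 𝟙 d′ ∸ t ≢ 0 → d ≡ true × b ≡ true × d′ ≡ false × t ≡ 0
𝟙-leftover≢0 true  true  false zero    _  = refl , refl , refl , refl
𝟙-leftover≢0 true  true  false (suc t) ≢0 = ⊥-elim (≢0 (0∸n≡0 t))
𝟙-leftover≢0 true  true  true  t       ≢0 = ⊥-elim (≢0 (0∸n≡0 t))
𝟙-leftover≢0 true  false d′    t       ≢0 = ⊥-elim (≢0 (0∸n≡0 t))
𝟙-leftover≢0 false b     d′    t       ≢0 = ⊥-elim (≢0 (trans (cong (_∸ t) (0∸n≡0 (𝟙 b * 𝟙 d′))) (0∸n≡0 t)))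

true≢false : true ≢ false
true≢false ()

m≤n+o+m∸n∸o : ∀ m n o → m ≤ n + o + (m ∸ n ∸ o)
m≤n+o+m∸n∸o m n o = begin
  m                      ≤⟨ m≤n+m∸n m n ⟩
  n + (m ∸ n)            ≤⟨ +-monoʳ-≤ n (m≤n+m∸n (m ∸ n) o) ⟩
  n + (o + (m ∸ n ∸ o))  ≡⟨ sym (+-assoc n o _) ⟩
  n + o + (m ∸ n ∸ o)    ∎
  where open ≤-Reasoning

sum-const : ∀ n c → ∑[ i < n ] c ≡ n * c
sum-const zero    c = refl
sum-const (suc n) c = cong (c +_) (sum-const n c)

sum-mono-≤ : ∀ {n} {f g : Fin n → ℕ} → (∀ i → f i ≤ g i) → sum f ≤ sum g
sum-mono-≤ {zero}  f≤g = z≤n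
sum-mono-≤ {suc n} f≤g = +-mono-≤ (f≤g zero) (sum-mono-≤ (f≤g ∘ suc))

term≤sum : ∀ {n} (f : Fin n → ℕ) i → f i ≤ sum f
term≤sum f zero    = m≤m+n _ _
term≤sum f (suc i) = ≤-trans (term≤sum (f ∘ suc) i) (m≤n+m _ _)

sum-supported-at : ∀ {n} (f : Fin n → ℕ) i → (∀ j → j ≢ i → f j ≡ 0) → sum f ≡ f i
sum-supported-at {suc n} f zero f≡0 = begin
  f zero + sum (f ∘ suc)      ≡⟨ cong (f zero +_) (sum-cong-≗ λ j → f≡0 (suc j) λ ()) ⟩
  f zero + ∑[ j < n ] 0        ≡⟨ cong (f zero +_) (sum-replicate-zero n) ⟩
  f zero + 0                  ≡⟨ +-identityʳ (f zero) ⟩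
  f zero                      ∎
  where open ≡-Reasoning
sum-supported-at {suc n} f (suc i) f≡0 =
  cong₂ _+_ (f≡0 zero λ ()) (sum-supported-at (f ∘ suc) i λ j j≢i → f≡0 (suc j) (j≢i ∘ suc-injective))

-- Sums over subsets

∑ˢ : ∀ {n} → (Subset n → ℕ) → ℕ
∑ˢ {zero}  f = f []
∑ˢ {suc n} f = ∑ˢ (f ∘ (inside ∷_)) + ∑ˢ (f ∘ (outside ∷_))

∑ˢ-cong : ∀ {n} {f g : Subset n → ℕ} → (∀ S → f S ≡ g S) → ∑ˢ f ≡ ∑ˢ g
∑ˢ-cong {zero}  f≗g = f≗g []
∑ˢ-cong {suc n} f≗g = cong₂ _+_ (∑ˢ-cong (f≗g ∘ (inside ∷_))) (∑ˢ-cong (f≗g ∘ (outside ∷_)))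

∑ˢ-mono-≤ : ∀ {n} {f g : Subset n → ℕ} → (∀ S → f S ≤ g S) → ∑ˢ f ≤ ∑ˢ g
∑ˢ-mono-≤ {zero}  f≤g = f≤g []
∑ˢ-mono-≤ {suc n} f≤g = +-mono-≤ (∑ˢ-mono-≤ (f≤g ∘ (inside ∷_))) (∑ˢ-mono-≤ (f≤g ∘ (outside ∷_)))

∑ˢ-zero : ∀ n → ∑ˢ {n} (λ _ → 0) ≡ 0
∑ˢ-zero zero    = refl
∑ˢ-zero (suc n) = cong₂ _+_ (∑ˢ-zero n) (∑ˢ-zero n)

∑ˢ-distrib-+ : ∀ {n} (f g : Subset n → ℕ) → ∑ˢ (λ S → f S + g S) ≡ ∑ˢ f + ∑ˢ g
∑ˢ-distrib-+ {zero}  f g = refl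
∑ˢ-distrib-+ {suc n} f g = trans
  (cong₂ _+_ (∑ˢ-distrib-+ (f ∘ (inside ∷_)) (g ∘ (inside ∷_)))
             (∑ˢ-distrib-+ (f ∘ (outside ∷_)) (g ∘ (outside ∷_))))
  (interchange (∑ˢ (f ∘ (inside ∷_))) (∑ˢ (g ∘ (inside ∷_))) (∑ˢ (f ∘ (outside ∷_))) (∑ˢ (g ∘ (outside ∷_))))

∑-∑ˢ-comm : ∀ {m n} (f : Fin m → Subset n → ℕ) → ∑[ v < m ] ∑ˢ (f v) ≡ ∑ˢ (λ S → ∑[ v < m ] f v S)
∑-∑ˢ-comm {zero}  {n} f = sym (∑ˢ-zero n)
∑-∑ˢ-comm {suc m}     f = trans (cong (∑ˢ (f zero) +_) (∑-∑ˢ-comm (f ∘ suc))) (sym (∑ˢ-distrib-+ (f zero) _))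

∑ˢ-∈≡∑ˢ-∉-insert : ∀ {n} v (f : Subset n → ℕ) →
  ∑ˢ (λ S → 𝟙 (lookup S v) * f S) ≡ ∑ˢ (λ T → 𝟙 (not (lookup T v)) * f (T [ v ]≔ inside))
∑ˢ-∈≡∑ˢ-∉-insert zero    f = +-comm (∑ˢ (λ S → f (inside ∷ S) + 0)) _
∑ˢ-∈≡∑ˢ-∉-insert (suc v) f =
  cong₂ _+_ (∑ˢ-∈≡∑ˢ-∉-insert v (f ∘ (inside ∷_))) (∑ˢ-∈≡∑ˢ-∉-insert v (f ∘ (outside ∷_)))

disjoint : ∀ {n} → Subset n → Subset n → Bool
disjoint []      []      = true
disjoint (m ∷ M) (s ∷ S) = not (m ∧ s) ∧ disjoint M S

-- Each S disjoint from M arises as T ─ M from exactly the 2 ^ ∣ M ∣ sets T that agree with S off M.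
∑ˢ-─ : ∀ {n} (M : Subset n) (g : Subset n → ℕ) →
  ∑ˢ (λ T → g (T ─ M)) ≡ 2 ^ ∣ M ∣ * ∑ˢ (λ S → 𝟙 (disjoint M S) * g S)
∑ˢ-─ []            g = sym (trans (+-identityʳ _) (+-identityʳ _))
∑ˢ-─ (outside ∷ M) g =
  trans (cong₂ _+_ (∑ˢ-─ M (g ∘ (inside ∷_))) (∑ˢ-─ M (g ∘ (outside ∷_)))) (sym (*-distribˡ-+ (2 ^ ∣ M ∣) _ _))
∑ˢ-─ {suc n} (inside ∷ M) g = begin
  ∑ˢ (λ T → g (outside ∷ (T ─ M))) + ∑ˢ (λ T → g (outside ∷ (T ─ M)))
    ≡⟨ cong₂ _+_ (∑ˢ-─ M (g ∘ (outside ∷_))) (∑ˢ-─ M (g ∘ (outside ∷_))) ⟩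
  2 ^ ∣ M ∣ * Y + 2 ^ ∣ M ∣ * Y
    ≡⟨ double (2 ^ ∣ M ∣) Y ⟩
  2 * 2 ^ ∣ M ∣ * (0 + Y)
    ≡⟨ cong (λ z → 2 * 2 ^ ∣ M ∣ * (z + Y)) (sym (∑ˢ-zero n)) ⟩
  2 * 2 ^ ∣ M ∣ * (∑ˢ {n} (λ _ → 0) + Y) ∎
  where
  open ≡-Reasoning
  Y = ∑ˢ (λ S → 𝟙 (disjoint M S) * g (outside ∷ S))
  double : ∀ a y → a * y + a * y ≡ 2 * a * (0 + y)
  double = solve-∀

disjoint-intro : ∀ {n} (M S : Subset n) → (∀ u → lookup M u ≡ true → lookup S u ≡ false) → disjoint M S ≡ true
disjoint-intro []            []      M∩S≡∅ = refl
disjoint-intro (outside ∷ M) (s ∷ S) M∩S≡∅ = disjoint-intro M S (M∩S≡∅ ∘ suc)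
disjoint-intro (inside ∷ M)  (s ∷ S) M∩S≡∅ rewrite M∩S≡∅ zero refl = disjoint-intro M S (M∩S≡∅ ∘ suc)

disjoint-witness : ∀ {n} (M S : Subset n) → disjoint M S ≡ false → ∃ λ u → lookup M u ≡ true × lookup S u ≡ true
disjoint-witness []            []            ()
disjoint-witness (inside ∷ M)  (inside ∷ S)  _ = zero , refl , refl
disjoint-witness (inside ∷ M)  (outside ∷ S) e with disjoint-witness M S e
... | u , u∈M , u∈S = suc u , u∈M , u∈S
disjoint-witness (outside ∷ M) (s ∷ S)       e with disjoint-witness M S e
... | u , u∈M , u∈S = suc u , u∈M , u∈S

disjoint⇒─≡ : ∀ {n} (M S : Subset n) → disjoint M S ≡ true → S ─ M ≡ S
disjoint⇒─≡ []            []            _ = refl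
disjoint⇒─≡ (inside ∷ M)  (outside ∷ S) e = cong (outside ∷_) (disjoint⇒─≡ M S e)
disjoint⇒─≡ (outside ∷ M) (s ∷ S)       e = cong (s ∷_) (disjoint⇒─≡ M S e)

lookup-─-∉ : ∀ {n} (M S : Subset n) v → lookup M v ≡ false → lookup (S ─ M) v ≡ lookup S v
lookup-─-∉ (outside ∷ M) (s ∷ S) zero    _   = refl
lookup-─-∉ (m ∷ M)       (s ∷ S) (suc v) v∉M = lookup-─-∉ M S v v∉M

─⊆ : ∀ {n} (M S : Subset n) u → lookup (S ─ M) u ≡ true → lookup S u ≡ true
─⊆ (outside ∷ M) (s ∷ S) zero    u∈S─M = u∈S─M
─⊆ (m ∷ M)       (s ∷ S) (suc u) u∈S─M = ─⊆ M S u u∈S─M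

length-filter≡sum : ∀ {A : Set} (p : A → Bool) xs →
  length (filter (λ x → p x Bool.≟ true) xs) ≡ L.sum (map (𝟙 ∘ p) xs)
length-filter≡sum p []       = refl
length-filter≡sum p (x ∷ xs) with p x
... | true  = cong suc (length-filter≡sum p xs)
... | false = length-filter≡sum p xs

sum-filter≡sum : ∀ {A : Set} (p : A → Bool) (f : A → ℕ) xs →
  L.sum (map f (filter (λ x → p x Bool.≟ true) xs)) ≡ L.sum (map (λ x → 𝟙 (p x) * f x) xs)
sum-filter≡sum p f []       = refl
sum-filter≡sum p f (x ∷ xs) with p x
... | true  = cong₂ _+_ (sym (+-identityʳ (f x))) (sum-filter≡sum p f xs)
... | false = sum-filter≡sum p f xs

sum-allSubsets : ∀ n (f : Subset n → ℕ) → L.sum (map f (allSubsets n)) ≡ ∑ˢ f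
sum-allSubsets zero    f = +-identityʳ (f [])
sum-allSubsets (suc n) f = begin
  L.sum (map f (map (inside ∷_) Ss ++ map (outside ∷_) Ss))
    ≡⟨ cong L.sum (map-++ f (map (inside ∷_) Ss) _) ⟩
  L.sum (map f (map (inside ∷_) Ss) ++ map f (map (outside ∷_) Ss))
    ≡⟨ sum-++ (map f (map (inside ∷_) Ss)) _ ⟩
  L.sum (map f (map (inside ∷_) Ss)) + L.sum (map f (map (outside ∷_) Ss))
    ≡⟨ cong₂ _+_ (cong L.sum (sym (map-∘ Ss))) (cong L.sum (sym (map-∘ Ss))) ⟩
  L.sum (map (f ∘ (inside ∷_)) Ss) + L.sum (map (f ∘ (outside ∷_)) Ss)
    ≡⟨ cong₂ _+_ (sum-allSubsets n _) (sum-allSubsets n _) ⟩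
  ∑ˢ f ∎
  where
  open ≡-Reasoning
  Ss = allSubsets n

sum-toList-tabulate : ∀ {n} {A : Set} (g : Fin n → A) (f : A → ℕ) →
  L.sum (map f (toList (tabulate g))) ≡ sum (f ∘ g)
sum-toList-tabulate {zero}  g f = refl
sum-toList-tabulate {suc n} g f = cong (f (g zero) +_) (sum-toList-tabulate (g ∘ suc) f)

∣∣≡sum : ∀ {n} (S : Subset n) → ∣ S ∣ ≡ ∑[ v < n ] 𝟙 (lookup S v)
∣∣≡sum []            = refl
∣∣≡sum (inside ∷ S)  = cong suc (∣∣≡sum S)
∣∣≡sum (outside ∷ S) = ∣∣≡sum S

∈-toList-tabulate : ∀ {n} {A : Set} (f : Fin n → A) i → f i ∈ toList (tabulate f)
∈-toList-tabulate f zero    = here refl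
∈-toList-tabulate f (suc i) = there (∈-toList-tabulate (f ∘ suc) i)

∨-falseˡ : ∀ {a b} → a ∨ b ≡ false → a ≡ false
∨-falseˡ {false} _ = refl

∨-falseʳ : ∀ {a b} → a ∨ b ≡ false → b ≡ false
∨-falseʳ {false} b≡false = b≡false

or-false : ∀ {A : Set} (p : A → Bool) {xs y} → y ∈ xs → foldr _∨_ false (map p xs) ≡ false → p y ≡ false
or-false p {x ∷ xs} (here refl)  e = ∨-falseˡ e
or-false p {x ∷ xs} (there y∈xs) e = or-false p y∈xs (∨-falseʳ {p x} e)

-- Domination

module _ {n} (G : Graph n) where

  -- `dominatedBy` tests membership through a local copy of the identity on `Side`
  -- that cannot be named here, so this direction is proved by refuting its negation.
  dominatedBy-neighbour : ∀ S x u → lookup S u ≡ true → adj G x u ≡ true → dominatedBy G S x ≡ true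
  dominatedBy-neighbour S x u u∈S x~u with dominatedBy G S x in undominated
  ... | true  = refl
  ... | false with or-false _ {toList (allFin n)} (∈-toList-tabulate id u) (∨-falseʳ undominated)
  ... | u-fails rewrite u∈S | x~u with u-fails
  ... | ()

  dominatedBy-member : ∀ S x → lookup S x ≡ true → dominatedBy G S x ≡ true
  dominatedBy-member S x x∈S rewrite x∈S = refl

  dominatedBy-witness : ∀ S x → dominatedBy G S x ≡ true →
    lookup S x ≡ true ⊎ ∃ λ u → lookup S u ≡ true × adj G x u ≡ true
  dominatedBy-witness S x dominated with lookup S x
  ... | true  = inj₁ refl
  ... | false with satisfied (any⁻ _ (toList (allFin n)) (Equivalence.from T-≡ dominated))
  ... | u , u-dominates with lookup S u in u∈S | adj G x u in x~u
  ... | true | true = inj₂ (u , u∈S , x~u)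
  dominatedBy-witness S x dominated | false | u , () | false | _
  dominatedBy-witness S x dominated | false | u , () | true  | false

  dominatedBy-mono : ∀ S S′ x → (∀ u → lookup S u ≡ true → lookup S′ u ≡ true) →
    dominatedBy G S x ≡ true → dominatedBy G S′ x ≡ true
  dominatedBy-mono S S′ x S⊆S′ dominated with dominatedBy-witness S x dominated
  ... | inj₁ x∈S             = dominatedBy-member S′ x (S⊆S′ x x∈S)
  ... | inj₂ (u , u∈S , x~u) = dominatedBy-neighbour S′ x u (S⊆S′ u u∈S) x~u

  isDominating⇒dominatedBy : ∀ S → isDominating G S ≡ true → ∀ x → dominatedBy G S x ≡ true
  isDominating⇒dominatedBy S dominating x = Equivalence.to T-≡
    (All.lookup (all⁺ _ (toList (allFin n)) (Equivalence.from T-≡ dominating)) (∈-toList-tabulate id x))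

  dominatedBy⇒isDominating : ∀ S → (∀ x → dominatedBy G S x ≡ true) → isDominating G S ≡ true
  dominatedBy⇒isDominating S dominated = Equivalence.to T-≡
    (all⁻ (dominatedBy G S) {toList (allFin n)} (All.tabulate λ {x} _ → Equivalence.from T-≡ (dominated x)))

  adj⇒≢ : ∀ {v u} → adj G v u ≡ true → u ≢ v
  adj⇒≢ {v} v~v refl = true≢false (trans (sym v~v) (irref G v))

  neighbourhood : Fin n → Subset n
  neighbourhood v = tabulate (adj G v)

  degree≡∣neighbourhood∣ : ∀ v → degree G v ≡ ∣ neighbourhood v ∣
  degree≡∣neighbourhood∣ v = begin
    degree G v                               ≡⟨ length-filter≡sum (adj G v) (toList (allFin n)) ⟩
    L.sum (map (𝟙 ∘ adj G v) (toList (allFin n))) ≡⟨ sum-toList-tabulate id (𝟙 ∘ adj G v) ⟩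
    ∑[ u < n ] 𝟙 (adj G v u)                  ≡⟨ sum-cong-≗ (λ u → cong 𝟙 (sym (lookup∘tabulate (adj G v) u))) ⟩
    ∑[ u < n ] 𝟙 (lookup (neighbourhood v) u) ≡⟨ sym (∣∣≡sum (neighbourhood v)) ⟩
    ∣ neighbourhood v ∣                       ∎
    where open ≡-Reasoning

  dom : Subset n → ℕ
  dom S = 𝟙 (isDominating G S)

  domContaining domAvoiding : Fin n → ℕ
  domContaining v = ∑ˢ λ S → dom S * 𝟙 (lookup S v)
  domAvoiding   v = ∑ˢ λ S → dom S * 𝟙 (not (lookup S v))

  numDom≡∑ˢdom : numDom G ≡ ∑ˢ dom
  numDom≡∑ˢdom = trans (length-filter≡sum (isDominating G) (allSubsets n)) (sum-allSubsets n dom)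

  totalDomSize≡∑domContaining : totalDomSize G ≡ sum domContaining
  totalDomSize≡∑domContaining = begin
    totalDomSize G                          ≡⟨ sum-filter≡sum (isDominating G) ∣_∣ (allSubsets n) ⟩
    L.sum (map (λ S → dom S * ∣ S ∣) (allSubsets n)) ≡⟨ sum-allSubsets n _ ⟩
    ∑ˢ (λ S → dom S * ∣ S ∣)
      ≡⟨ ∑ˢ-cong (λ S → trans (cong (dom S *_) (∣∣≡sum S)) (*-distribˡ-sum (dom S) (𝟙 ∘ lookup S))) ⟩
    ∑ˢ (λ S → ∑[ v < n ] (dom S * 𝟙 (lookup S v))) ≡⟨ sym (∑-∑ˢ-comm (λ v S → dom S * 𝟙 (lookup S v))) ⟩
    sum domContaining                       ∎
    where open ≡-Reasoning

  n*∑ˢdom≡∑domContaining+∑domAvoiding : n * ∑ˢ dom ≡ sum domContaining + sum domAvoiding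
  n*∑ˢdom≡∑domContaining+∑domAvoiding = begin
    n * ∑ˢ dom                                       ≡⟨ sym (sum-const n (∑ˢ dom)) ⟩
    ∑[ v < n ] ∑ˢ dom
      ≡⟨ sum-cong-≗ (λ v → ∑ˢ-cong (λ S → 𝟙-split (dom S) (lookup S v))) ⟩
    ∑[ v < n ] ∑ˢ (λ S → dom S * 𝟙 (lookup S v) + dom S * 𝟙 (not (lookup S v)))
      ≡⟨ sum-cong-≗ (λ v → ∑ˢ-distrib-+ (λ S → dom S * 𝟙 (lookup S v)) (λ S → dom S * 𝟙 (not (lookup S v)))) ⟩
    ∑[ v < n ] (domContaining v + domAvoiding v)     ≡⟨ ∑-distrib-+ domContaining domAvoiding ⟩
    sum domContaining + sum domAvoiding ∎
    where open ≡-Reasoning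

  neighboursIn : Subset n → Fin n → ℕ
  neighboursIn S p = ∑[ u < n ] (𝟙 (lookup S u) * 𝟙 (adj G p u))

  lonelyOutside : Subset n → Fin n → ℕ
  lonelyOutside S p = 𝟙 (not (lookup S p)) * 𝟙 (neighboursIn S p ≡ᵇ 1)

  -- The three cases for a member v of a dominating set S. The truncated subtraction makes
  -- `membership-cover` trivial; `Residual` records what a nonzero residual forces.
  removable privateNeighbours residual : Subset n → Fin n → ℕ
  removable S v = 𝟙 (lookup S v) * dom (S [ v ]≔ outside)
  privateNeighbours S v = dom S * ∑[ p < n ] (lonelyOutside S p * (𝟙 (lookup S v) * 𝟙 (adj G p v)))
  residual S v = dom S * 𝟙 (lookup S v) ∸ removable S v ∸ privateNeighbours S v

  membership-cover : ∀ S v → dom S * 𝟙 (lookup S v) ≤ removable S v + privateNeighbours S v + residual S v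
  membership-cover S v = m≤n+o+m∸n∸o (dom S * 𝟙 (lookup S v)) (removable S v) (privateNeighbours S v)

  residual≤1 : ∀ S v → residual S v ≤ 1
  residual≤1 S v = begin
    residual S v                             ≤⟨ m∸n≤m _ (privateNeighbours S v) ⟩
    dom S * 𝟙 (lookup S v) ∸ removable S v  ≤⟨ m∸n≤m _ (removable S v) ⟩
    dom S * 𝟙 (lookup S v)                  ≤⟨ *-monoˡ-≤ (𝟙 (lookup S v)) (𝟙≤1 (isDominating G S)) ⟩
    1 * 𝟙 (lookup S v)                      ≤⟨ 𝟙*≤ true (𝟙 (lookup S v)) ⟩
    𝟙 (lookup S v)                          ≤⟨ 𝟙≤1 (lookup S v) ⟩
    1                                       ∎
    where open ≤-Reasoning

  record Residual (S : Subset n) (v : Fin n) : Set where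
    field
      dominating         : isDominating G S ≡ true
      member             : lookup S v ≡ true
      deletionFails      : isDominating G (S [ v ]≔ outside) ≡ false
      noPrivateNeighbour : privateNeighbours S v ≡ 0

  residual≢0⇒Residual : ∀ S v → residual S v ≢ 0 → Residual S v
  residual≢0⇒Residual S v r≢0
    with 𝟙-leftover≢0 (isDominating G S) (lookup S v) (isDominating G (S [ v ]≔ outside)) _ r≢0
  ... | dominating , member , deletionFails , noPrivate = record
    { dominating         = dominating
    ; member             = member
    ; deletionFails      = deletionFails
    ; noPrivateNeighbour = noPrivate
    }

  neighboursIn≡1 : ∀ S x v → lookup S v ≡ true → adj G x v ≡ true →
    (∀ u → lookup S u ≡ true → adj G x u ≡ true → u ≡ v) → neighboursIn S x ≡ 1
  neighboursIn≡1 S x v v∈S x~v unique = begin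
    neighboursIn S x                ≡⟨ sum-supported-at _ v others ⟩
    𝟙 (lookup S v) * 𝟙 (adj G x v)  ≡⟨ cong₂ (λ a b → 𝟙 a * 𝟙 b) v∈S x~v ⟩
    1                               ∎
    where
    open ≡-Reasoning
    others : ∀ u → u ≢ v → 𝟙 (lookup S u) * 𝟙 (adj G x u) ≡ 0
    others u u≢v with lookup S u in u∈S | adj G x u in x~u
    ... | true  | true  = ⊥-elim (u≢v (unique u u∈S x~u))
    ... | true  | false = refl
    ... | false | _     = refl

  privateNeighbour⇒1≤privateNeighbours : ∀ S v x → isDominating G S ≡ true → lookup S v ≡ true →
    lookup S x ≡ false → adj G x v ≡ true → neighboursIn S x ≡ 1 → 1 ≤ privateNeighbours S v
  privateNeighbour⇒1≤privateNeighbours S v x dominating v∈S x∉S x~v lonely = begin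
    1                       ≡⟨ sym x-counted ⟩
    counted x               ≤⟨ term≤sum counted x ⟩
    sum counted             ≡⟨ sym (*-identityˡ (sum counted)) ⟩
    1 * sum counted         ≡⟨ cong (λ d → 𝟙 d * sum counted) (sym dominating) ⟩
    privateNeighbours S v   ∎
    where
    open ≤-Reasoning
    counted : Fin n → ℕ
    counted p = lonelyOutside S p * (𝟙 (lookup S v) * 𝟙 (adj G p v))
    x-counted : counted x ≡ 1
    x-counted rewrite x∉S | lonely | v∈S | x~v = refl

  residual⇒others-dominated : ∀ S v → residual S v ≢ 0 →
    ∀ x → x ≢ v → dominatedBy G (S [ v ]≔ outside) x ≡ true
  residual⇒others-dominated S v r≢0 x x≢v with dominatedBy G (S [ v ]≔ outside) x in undominated
  ... | true  = refl
  ... | false = ⊥-elim (refute (dominatedBy-witness S x (isDominating⇒dominatedBy S dominating x)))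
    where
    open Residual (residual≢0⇒Residual S v r≢0)
    S′ = S [ v ]≔ outside
    kept : ∀ u → u ≢ v → lookup S u ≡ true → lookup S′ u ≡ true
    kept u u≢v u∈S = trans (lookup∘update′ u≢v S outside) u∈S
    ¬dominated : dominatedBy G S′ x ≢ true
    ¬dominated dominated = true≢false (trans (sym dominated) undominated)
    onlyNeighbour : ∀ u → lookup S u ≡ true → adj G x u ≡ true → u ≡ v
    onlyNeighbour u u∈S x~u with u ≟ v
    ... | yes u≡v = u≡v
    ... | no  u≢v = ⊥-elim (¬dominated (dominatedBy-neighbour S′ x u (kept u u≢v u∈S) x~u))
    x∉S : lookup S x ≡ false
    x∉S with lookup S x in x∈S
    ... | true  = ⊥-elim (¬dominated (dominatedBy-member S′ x (kept x x≢v x∈S)))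
    ... | false = refl
    refute : lookup S x ≡ true ⊎ ∃ (λ u → lookup S u ≡ true × adj G x u ≡ true) → ⊥
    refute (inj₁ x∈S) = true≢false (trans (sym x∈S) x∉S)
    refute (inj₂ (u , u∈S , x~u)) with onlyNeighbour u u∈S x~u
    ... | refl = <-irrefl refl (≤-trans
      (privateNeighbour⇒1≤privateNeighbours S v x dominating member x∉S x~u
        (neighboursIn≡1 S x v member x~u onlyNeighbour))
      (≤-reflexive noPrivateNeighbour))

  residual⇒isolated : ∀ S v → residual S v ≢ 0 → ∀ u → adj G v u ≡ true → lookup S u ≡ false
  residual⇒isolated S v r≢0 u v~u with lookup S u in u∈S
  ... | false = refl
  ... | true  = ⊥-elim (true≢false (trans (sym (dominatedBy⇒isDominating S′ dominated)) deletionFails))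
    where
    open Residual (residual≢0⇒Residual S v r≢0)
    S′ = S [ v ]≔ outside
    dominated : ∀ x → dominatedBy G S′ x ≡ true
    dominated x with x ≟ v
    ... | yes refl = dominatedBy-neighbour S′ v u (trans (lookup∘update′ (adj⇒≢ v~u) S outside) u∈S) v~u
    ... | no  x≢v  = residual⇒others-dominated S v r≢0 x x≢v

  ∑ˢ-removable : ∀ v → ∑ˢ (λ S → removable S v) ≡ domAvoiding v
  ∑ˢ-removable v = trans (∑ˢ-∈≡∑ˢ-∉-insert v (λ S → dom (S [ v ]≔ outside))) (∑ˢ-cong reinsert)
    where
    reinsert : ∀ T →
      𝟙 (not (lookup T v)) * dom ((T [ v ]≔ inside) [ v ]≔ outside) ≡ dom T * 𝟙 (not (lookup T v))
    reinsert T rewrite []≔-idempotent {x = inside} {y = outside} T v with lookup T v in v∈T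
    ... | true  = sym (*-zeroʳ (dom T))
    ... | false rewrite trans (cong (T [ v ]≔_) (sym v∈T)) ([]≔-lookup T v) = *-comm 1 (dom T)

  ∑privateNeighbours≤dom*outside : ∀ S →
    ∑[ v < n ] privateNeighbours S v ≤ dom S * ∑[ p < n ] 𝟙 (not (lookup S p))
  ∑privateNeighbours≤dom*outside S = begin
    ∑[ v < n ] (dom S * ∑[ p < n ] (lonelyOutside S p * neighbour v p))
      ≡⟨ sym (*-distribˡ-sum (dom S) (λ v → ∑[ p < n ] (lonelyOutside S p * neighbour v p))) ⟩
    dom S * ∑[ v < n ] ∑[ p < n ] (lonelyOutside S p * neighbour v p)
      ≡⟨ cong (dom S *_) (∑-comm (λ v p → lonelyOutside S p * neighbour v p)) ⟩
    dom S * ∑[ p < n ] ∑[ v < n ] (lonelyOutside S p * neighbour v p)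
      ≡⟨ cong (dom S *_) (sum-cong-≗ λ p → sym (*-distribˡ-sum (lonelyOutside S p) (λ v → neighbour v p))) ⟩
    dom S * ∑[ p < n ] (lonelyOutside S p * neighboursIn S p)
      ≤⟨ *-monoʳ-≤ (dom S) (sum-mono-≤ lonely≤outside) ⟩
    dom S * ∑[ p < n ] 𝟙 (not (lookup S p)) ∎
    where
    open ≤-Reasoning
    neighbour : Fin n → Fin n → ℕ
    neighbour v p = 𝟙 (lookup S v) * 𝟙 (adj G p v)
    lonely≤outside : ∀ p → lonelyOutside S p * neighboursIn S p ≤ 𝟙 (not (lookup S p))
    lonely≤outside p with neighboursIn S p ≡ᵇ 1 in one
    ... | false rewrite *-zeroʳ (𝟙 (not (lookup S p))) = z≤n
    ... | true rewrite ≡ᵇ⇒≡ (neighboursIn S p) 1 (Equivalence.from T-≡ one) =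
      ≤-reflexive (trans (*-identityʳ _) (*-identityʳ _))

  ∑∑ˢprivateNeighbours≤∑domAvoiding : ∑[ v < n ] ∑ˢ (λ S → privateNeighbours S v) ≤ sum domAvoiding
  ∑∑ˢprivateNeighbours≤∑domAvoiding = begin
    ∑[ v < n ] ∑ˢ (λ S → privateNeighbours S v)          ≡⟨ ∑-∑ˢ-comm (λ v S → privateNeighbours S v) ⟩
    ∑ˢ (λ S → ∑[ v < n ] privateNeighbours S v)          ≤⟨ ∑ˢ-mono-≤ ∑privateNeighbours≤dom*outside ⟩
    ∑ˢ (λ S → dom S * ∑[ p < n ] 𝟙 (not (lookup S p)))
      ≡⟨ ∑ˢ-cong (λ S → *-distribˡ-sum (dom S) (𝟙 ∘ not ∘ lookup S)) ⟩
    ∑ˢ (λ S → ∑[ p < n ] (dom S * 𝟙 (not (lookup S p))))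
      ≡⟨ sym (∑-∑ˢ-comm (λ p S → dom S * 𝟙 (not (lookup S p)))) ⟩
    sum domAvoiding                                     ∎
    where open ≤-Reasoning

  v∉neighbourhood : ∀ v → lookup (neighbourhood v) v ≡ false
  v∉neighbourhood v = trans (lookup∘tabulate (adj G v) v) (irref G v)

  -- Residual sets containing v, indexed by T = S − v.
  insertedResidual : Fin n → Subset n → ℕ
  insertedResidual v T = 𝟙 (not (lookup T v)) * residual (T [ v ]≔ inside) v

  ∑ˢresidual≡∑ˢinsertedResidual : ∀ v → ∑ˢ (λ S → residual S v) ≡ ∑ˢ (insertedResidual v)
  ∑ˢresidual≡∑ˢinsertedResidual v =
    trans (∑ˢ-cong λ S → 𝟙*-absorb (residual S v) (Residual.member ∘ residual≢0⇒Residual S v))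
          (∑ˢ-∈≡∑ˢ-∉-insert v (λ S → residual S v))

  insertedResidual≢0 : ∀ v T → insertedResidual v T ≢ 0 →
    lookup T v ≡ false × residual (T [ v ]≔ inside) v ≢ 0
  insertedResidual≢0 v T g≢0 with 𝟙*≢0 (not (lookup T v)) (residual (T [ v ]≔ inside) v) g≢0
  ... | v∉T , r≢0 = not-injective v∉T , r≢0

  insertedResidual≤1 : ∀ v T → insertedResidual v T ≤ 1
  insertedResidual≤1 v T = ≤-trans (𝟙*≤ (not (lookup T v)) _) (residual≤1 (T [ v ]≔ inside) v)

  insertedResidual≡𝟙disjoint* : ∀ v T →
    insertedResidual v T ≡ 𝟙 (disjoint (neighbourhood v) T) * insertedResidual v T
  insertedResidual≡𝟙disjoint* v T = 𝟙*-absorb (insertedResidual v T) λ g≢0 →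
    disjoint-intro (neighbourhood v) T λ u u∈N →
      let v~u = trans (sym (lookup∘tabulate (adj G v) u)) u∈N in
      trans (sym (lookup∘update′ (adj⇒≢ v~u) T inside))
            (residual⇒isolated (T [ v ]≔ inside) v (proj₂ (insertedResidual≢0 v T g≢0)) u v~u)

  -- If T meets N(v), then T ─ N(v) can only come from a residual set when T itself is a
  -- dominating set avoiding v: v is dominated through T ∩ N(v), every other vertex by T ─ N(v).
  insertedResidual-trimmed : ∀ v T → disjoint (neighbourhood v) T ≡ false →
    insertedResidual v (T ─ neighbourhood v) ≤ dom T * 𝟙 (not (lookup T v))
  insertedResidual-trimmed v T meets with insertedResidual v (T ─ neighbourhood v) ≟ℕ 0
  ... | yes g≡0 = ≤-trans (≤-reflexive g≡0) z≤n
  ... | no  g≢0 with insertedResidual≢0 v (T ─ neighbourhood v) g≢0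
  ... | C∌v , r≢0 = ≤-trans (insertedResidual≤1 v C) (≤-reflexive (sym T-counted))
    where
    N = neighbourhood v
    C = T ─ N
    T∌v : lookup T v ≡ false
    T∌v = trans (sym (lookup-─-∉ N T v (v∉neighbourhood v))) C∌v
    restore : (C [ v ]≔ inside) [ v ]≔ outside ≡ C
    restore = trans ([]≔-idempotent C v) (trans (cong (C [ v ]≔_) (sym C∌v)) ([]≔-lookup C v))
    dominated : ∀ x → dominatedBy G T x ≡ true
    dominated x with x ≟ v
    ... | yes refl with disjoint-witness N T meets
    ...   | u , u∈N , u∈T = dominatedBy-neighbour T v u u∈T (trans (sym (lookup∘tabulate (adj G v) u)) u∈N)
    dominated x | no x≢v = dominatedBy-mono C T x (─⊆ N T)
      (subst (λ Z → dominatedBy G Z x ≡ true) restore (residual⇒others-dominated (C [ v ]≔ inside) v r≢0 x x≢v))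
    T-counted : dom T * 𝟙 (not (lookup T v)) ≡ 1
    T-counted rewrite dominatedBy⇒isDominating T dominated | T∌v = refl

  insertedResidual-─ : ∀ v T →
    insertedResidual v (T ─ neighbourhood v) ≤ insertedResidual v T + dom T * 𝟙 (not (lookup T v))
  insertedResidual-─ v T with disjoint (neighbourhood v) T in disj
  ... | true  rewrite disjoint⇒─≡ (neighbourhood v) T disj = m≤m+n _ _
  ... | false = ≤-trans (insertedResidual-trimmed v T disj) (m≤n+m _ _)

  residual-bound : ∀ v → (2 ^ ∣ neighbourhood v ∣ ∸ 1) * ∑ˢ (λ S → residual S v) ≤ domAvoiding v
  residual-bound v = begin
    (2 ^ d ∸ 1) * ∑ˢ (λ S → residual S v) ≡⟨ cong ((2 ^ d ∸ 1) *_) (∑ˢresidual≡∑ˢinsertedResidual v) ⟩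
    (2 ^ d ∸ 1) * Y                       ≡⟨ *-distribʳ-∸ Y (2 ^ d) 1 ⟩
    2 ^ d * Y ∸ 1 * Y                     ≡⟨ cong (2 ^ d * Y ∸_) (*-identityˡ Y) ⟩
    2 ^ d * Y ∸ Y                         ≤⟨ m≤n+o⇒m∸n≤o (2 ^ d * Y) Y shifted ⟩
    domAvoiding v                         ∎
    where
    open ≤-Reasoning
    N = neighbourhood v
    d = ∣ N ∣
    Y = ∑ˢ (insertedResidual v)
    shifted : 2 ^ d * Y ≤ Y + domAvoiding v
    shifted = begin
      2 ^ d * Y
        ≡⟨ cong (2 ^ d *_) (∑ˢ-cong (insertedResidual≡𝟙disjoint* v)) ⟩
      2 ^ d * ∑ˢ (λ T → 𝟙 (disjoint N T) * insertedResidual v T)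
        ≡⟨ sym (∑ˢ-─ N (insertedResidual v)) ⟩
      ∑ˢ (λ T → insertedResidual v (T ─ N))
        ≤⟨ ∑ˢ-mono-≤ (insertedResidual-─ v) ⟩
      ∑ˢ (λ T → insertedResidual v T + dom T * 𝟙 (not (lookup T v)))
        ≡⟨ ∑ˢ-distrib-+ (insertedResidual v) (λ T → dom T * 𝟙 (not (lookup T v))) ⟩
      Y + domAvoiding v ∎

  domContaining≤ : ∀ v →
    domContaining v ≤ domAvoiding v + ∑ˢ (λ S → privateNeighbours S v) + ∑ˢ (λ S → residual S v)
  domContaining≤ v = begin
    domContaining v
      ≤⟨ ∑ˢ-mono-≤ (λ S → membership-cover S v) ⟩
    ∑ˢ (λ S → removable S v + privateNeighbours S v + residual S v)
      ≡⟨ ∑ˢ-distrib-+ (λ S → removable S v + privateNeighbours S v) (λ S → residual S v) ⟩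
    ∑ˢ (λ S → removable S v + privateNeighbours S v) + ∑ˢ (λ S → residual S v)
      ≡⟨ cong (_+ ∑ˢ (λ S → residual S v)) (∑ˢ-distrib-+ (λ S → removable S v) (λ S → privateNeighbours S v)) ⟩
    ∑ˢ (λ S → removable S v) + ∑ˢ (λ S → privateNeighbours S v) + ∑ˢ (λ S → residual S v)
      ≡⟨ cong (λ z → z + ∑ˢ (λ S → privateNeighbours S v) + ∑ˢ (λ S → residual S v)) (∑ˢ-removable v) ⟩
    domAvoiding v + ∑ˢ (λ S → privateNeighbours S v) + ∑ˢ (λ S → residual S v) ∎
    where open ≤-Reasoning

  key-inequality : ∀ m → (∀ v → m ≤ 2 ^ ∣ neighbourhood v ∣ ∸ 1) →
    m * sum domContaining ≤ m * sum domAvoiding + m * sum domAvoiding + sum domAvoiding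
  key-inequality m m≤ = begin
    m * sum domContaining
      ≤⟨ *-monoʳ-≤ m (sum-mono-≤ domContaining≤) ⟩
    m * ∑[ v < n ] (domAvoiding v + P v + R v)
      ≡⟨ cong (m *_) (trans (∑-distrib-+ (λ v → domAvoiding v + P v) R)
                            (cong (_+ sum R) (∑-distrib-+ domAvoiding P))) ⟩
    m * (A + sum P + sum R)
      ≡⟨ trans (*-distribˡ-+ m (A + sum P) (sum R)) (cong (_+ m * sum R) (*-distribˡ-+ m A (sum P))) ⟩
    m * A + m * sum P + m * sum R
      ≤⟨ +-mono-≤ (+-monoʳ-≤ (m * A) (*-monoʳ-≤ m ∑∑ˢprivateNeighbours≤∑domAvoiding)) weighted-residual ⟩
    m * A + m * A + A ∎
    where
    open ≤-Reasoning
    A = sum domAvoiding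
    P R : Fin n → ℕ
    P v = ∑ˢ (λ S → privateNeighbours S v)
    R v = ∑ˢ (λ S → residual S v)
    weighted-residual : m * sum R ≤ A
    weighted-residual = begin
      m * sum R                 ≡⟨ *-distribˡ-sum m R ⟩
      ∑[ v < n ] (m * R v)      ≤⟨ sum-mono-≤ (λ v → ≤-trans (*-monoˡ-≤ (R v) (m≤ v)) (residual-bound v)) ⟩
      A                         ∎

avd-bound : ∀ n m p a d → n * d ≡ p + a → m * p ≤ m * a + m * a + a → p * (3 * m + 1) ≤ (2 * n * m + n) * d
avd-bound n m p a d n*d≡p+a m*p≤ = begin
  p * (3 * m + 1)                 ≡⟨ split m p ⟩
  (2 * m * p + p) + m * p          ≤⟨ +-monoʳ-≤ (2 * m * p + p) m*p≤ ⟩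
  (2 * m * p + p) + (m * a + m * a + a) ≡⟨ collect m p a ⟩
  (2 * m + 1) * (p + a)            ≡⟨ cong ((2 * m + 1) *_) (sym n*d≡p+a) ⟩
  (2 * m + 1) * (n * d)            ≡⟨ regroup m n d ⟩
  (2 * n * m + n) * d              ∎
  where
  open ≤-Reasoning
  split : ∀ m p → p * (3 * m + 1) ≡ (2 * m * p + p) + m * p
  split = solve-∀
  collect : ∀ m p a → (2 * m * p + p) + (m * a + m * a + a) ≡ (2 * m + 1) * (p + a)
  collect = solve-∀
  regroup : ∀ m n d → (2 * m + 1) * (n * d) ≡ (2 * n * m + n) * d
  regroup = solve-∀

avd-bound⇒three-quarters : ∀ n m p d → 1 ≤ m → p * (3 * m + 1) ≤ (2 * n * m + n) * d → p * 4 ≤ 3 * n * d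
avd-bound⇒three-quarters n m p d 1≤m bound = *-cancelʳ-≤ (p * 4) (3 * n * d) (suc (3 * m)) (begin
  p * 4 * suc (3 * m)              ≡⟨ scale p m ⟩
  4 * (p * (3 * m + 1))            ≤⟨ *-monoʳ-≤ 4 bound ⟩
  4 * ((2 * n * m + n) * d)        ≡⟨ expand n m d ⟩
  ((8 * m + 3) + 1) * (n * d)      ≤⟨ *-monoˡ-≤ (n * d) (+-monoʳ-≤ (8 * m + 3) 1≤m) ⟩
  ((8 * m + 3) + m) * (n * d)      ≡⟨ contract n m d ⟩
  3 * n * d * suc (3 * m)          ∎)
  where
  open ≤-Reasoning
  scale : ∀ p m → p * 4 * suc (3 * m) ≡ 4 * (p * (3 * m + 1))
  scale = solve-∀
  expand : ∀ n m d → 4 * ((2 * n * m + n) * d) ≡ ((8 * m + 3) + 1) * (n * d)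
  expand = solve-∀
  contract : ∀ n m d → ((8 * m + 3) + m) * (n * d) ≡ 3 * n * d * suc (3 * m)
  contract = solve-∀

-- The hypothesis n ≥ 2 is implied by δ ≥ 1 and not needed.
theorem3p3 : (n : ℕ) → 2 ≤ n → (G : Graph n) → (δ : ℕ) → IsMinDegree G δ → 1 ≤ δ →
    AvdLeq G (2 * n * (2 ^ δ ∸ 1) + n) (3 * (2 ^ δ ∸ 1) + 1) × AvdLeq G (3 * n) 4
theorem3p3 n _ G δ (δ≤degree , _) 1≤δ = bound , avd-bound⇒three-quarters n m (totalDomSize G) (numDom G) 1≤m bound
  where
  m = 2 ^ δ ∸ 1
  1≤m : 1 ≤ m
  1≤m = ∸-monoˡ-≤ 1 (^-monoʳ-≤ 2 1≤δ)
  m≤ : ∀ v → m ≤ 2 ^ ∣ neighbourhood G v ∣ ∸ 1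
  m≤ v = ∸-monoˡ-≤ 1 (^-monoʳ-≤ 2 (subst (δ ≤_) (degree≡∣neighbourhood∣ G v) (δ≤degree v)))
  bound : AvdLeq G (2 * n * m + n) (3 * m + 1)
  bound rewrite totalDomSize≡∑domContaining G | numDom≡∑ˢdom G =
    avd-bound n m (sum (domContaining G)) (sum (domAvoiding G)) (∑ˢ (dom G))
      (n*∑ˢdom≡∑domContaining+∑domAvoiding G) (key-inequality G m m≤)
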